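{- Let $n,p,r$ be positive integers. Then $$ \sum_{\ell=0}^n \ell^{p}H_{n-\ell}^{(r)}=\sum_{t=0}^{p+1} H_{n-1}^{(r-t)} \sum_{\ell=1}^{p} S(p,\ell)\,\ell!\, a_{6}(\ell,n,t), $$ where $$ a_{6}(\ell,n,t)=\frac{1}{(\ell+1)!}\sum_{i=t}^{\ell+1} s(\ell+1,i) \binom{i}{t} (-1)^{t} (n+1)^{i-t} $$ (an empty sum being $0$).
   Context: For every integer $m$ (possibly zero or negative) and $N\ge0$, $H_N^{(m)}=\sum_{j=1}^N j^{ -m}$ (so $H_0^{(m)}=0$). $S(p,\ell)$ denotes Stirling numbers of the second kind ($x^p=\sum_\ell S(p,\ell)x(x-1)\cdots(x-\ell+1)$) and $s(k,i)$ the signed Stirling numbers of the first kind ($x(x-1)\cdots(x-k+1)=\sum_i s(k,i)x^i$). The convention $0^0=1$ is used. -}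

module Defs where

open import Data.Nat as ℕ using (ℕ; zero; suc; _∸_; _!)
open import Data.Nat.Properties using (m^n≢0; _!≢0)
open import Data.Nat.Combinatorics using (_C_)
open import Data.Integer as ℤ using (ℤ; +_; -[1+_])
open import Data.Rational as ℚ using (ℚ; 0ℚ; _+_; _*_)

-- Σ_{i=a}^{b} f i over ℚ (empty, i.e. 0, when b < a)
sumFromTo : ℕ → ℕ → (ℕ → ℚ) → ℚ
sumFromTo a b f = go (suc b ∸ a)
  where
  go : ℕ → ℚ
  go zero    = 0ℚ
  go (suc k) = go k + f (a ℕ.+ k)

ℕ→ℚ : ℕ → ℚ
ℕ→ℚ n = (+ n) ℚ./ 1

ℤ→ℚ : ℤ → ℚ
ℤ→ℚ z = z ℚ./ 1

powℤ : ℕ → ℤ → ℚ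
powℤ j (+ k)      = ℕ→ℚ (suc j ℕ.^ k)
powℤ j -[1+ k ]   = ℚ._/_ (+ 1) (suc j ℕ.^ suc k) {{m^n≢0 (suc j) (suc k)}}

-- H_N^{(m)} = Σ_{j=1}^{N} j^{-m}
H : ℕ → ℤ → ℚ
H N m = sumFromTo 1 N (λ j → powℤ (j ∸ 1) (ℤ.- m))

S₂ : ℕ → ℕ → ℕ
S₂ zero    zero    = 1
S₂ zero    (suc k) = 0
S₂ (suc n) zero    = 0
S₂ (suc n) (suc k) = suc k ℕ.* S₂ n (suc k) ℕ.+ S₂ n k

-- signed Stirling numbers of the first kind s(n,k):
-- x(x-1)...(x-n+1) = Σ_k s(n,k) x^k
s₁ : ℕ → ℕ → ℤ
s₁ zero    zero    = + 1
s₁ zero    (suc k) = + 0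
s₁ (suc n) zero    = ℤ.- (+ n ℤ.* s₁ n zero)
s₁ (suc n) (suc k) = s₁ n k ℤ.- (+ n ℤ.* s₁ n (suc k))

a₆ : ℕ → ℕ → ℕ → ℚ
a₆ ℓ n t =
  ℚ._/_ (+ 1) (suc ℓ !) {{(suc ℓ) !≢0}} *
  sumFromTo t (suc ℓ) (λ i →
    ℤ→ℚ (s₁ (suc ℓ) i ℤ.* + (i C t) ℤ.* ((ℤ.- + 1) ℤ.^ t)
         ℤ.* + (suc n ℕ.^ (i ∸ t))))

module Submission where

-- Exchanging the two summations turns the left side into Σ_{k<n} (k+1)^{-r} Σ_{x<n-k} x^p.
-- By the Stirling expansion x^p = Σ_ℓ S(p,ℓ) ℓ! C(x,ℓ) and the hockey-stick identity the
-- inner power sum is Σ_ℓ S(p,ℓ) ℓ! C(n-k,ℓ+1).  Writing C(n-k,ℓ+1) as the falling factorial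
-- Σ_i s(ℓ+1,i) (n-k)^i / (ℓ+1)! and expanding (n-k)^i = ((n+1) - (k+1))^i binomially gives
-- C(n-k,ℓ+1) = Σ_t (k+1)^t a₆(ℓ,n,t).  The term k = n-1 vanishes since C(1,ℓ+1) = 0 for
-- ℓ ≥ 1, and summing (k+1)^{t-r} over k < n-1 produces H_{n-1}^{(r-t)}.

open import Defs
open import Algebra.Bundles using (CommutativeRing; CommutativeSemiring)
open import Data.Fin using (Fin; toℕ)
open import Data.Integer as ℤ using (+_; _-_; -[1+_])
import Data.Integer.Properties as ℤ
open import Data.Integer.Tactic.RingSolver as ℤ-Solver using ()
open import Data.Nat using (ℕ; zero; suc; _∸_; _^_; _≤_; _<_; _≥_; s≤s)
open import Data.Nat as ℕ using (_!)
open import Data.Nat.Combinatorics using (_C_; nC1≡n; nCk+nC[k+1]≡[n+1]C[k+1]; k>n⇒nCk≡0)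
import Data.Nat.Properties as ℕ
open import Data.Nat.Tactic.RingSolver as ℕ-Solver using ()
open import Data.Rational as ℚ using (ℚ; 0ℚ; 1ℚ; _+_; _*_; -_)
import Data.Rational.Properties as ℚ
import Data.Rational.Unnormalised as ℚᵘ
import Data.Rational.Unnormalised.Properties as ℚᵘ
import Data.Vec.Functional as Vector
open import Function using (_∘_)
open import Level using (0ℓ)
open import Relation.Binary.PropositionalEquality using (_≡_; refl; sym; trans; cong; cong₂; module ≡-Reasoning)
open import Relation.Nullary.Decidable using (dec⇒maybe)
import Tactic.RingSolver.Core.AlmostCommutativeRing as ACR
open import Tactic.RingSolver using (solve-∀)
open ≡-Reasoning

ℚ-ring : ACR.AlmostCommutativeRing 0ℓ 0ℓ
ℚ-ring = ACR.fromCommutativeRing ℚ.+-*-commutativeRing (λ x → dec⇒maybe (0ℚ ℚ.≟ x))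

ℚ-commutativeSemiring : CommutativeSemiring 0ℓ 0ℓ
ℚ-commutativeSemiring = CommutativeRing.commutativeSemiring ℚ.+-*-commutativeRing

open import Algebra.Properties.CommutativeSemiring.Exp ℚ-commutativeSemiring
  using (^-distrib-*) renaming (_^_ to _^ℚ_)
import Algebra.Properties.CommutativeSemiring.Binomial ℚ-commutativeSemiring as Binomial
open import Algebra.Properties.Semiring.Mult (CommutativeSemiring.semiring ℚ-commutativeSemiring) using (_×_)

∑< : ℕ → (ℕ → ℚ) → ℚ
∑< zero    f = 0ℚ
∑< (suc n) f = ∑< n f + f n

infix 5 ∑<
syntax ∑< n (λ i → e) = ∑[ i < n ] e

module _ {f g : ℕ → ℚ} where

  ∑-cong-< : ∀ n → (∀ i → i < n → f i ≡ g i) → ∑< n f ≡ ∑< n g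
  ∑-cong-< zero    eq = refl
  ∑-cong-< (suc n) eq = cong₂ _+_ (∑-cong-< n (λ i i<n → eq i (ℕ.m<n⇒m<1+n i<n))) (eq n ℕ.≤-refl)

  ∑-cong : ∀ n → (∀ i → f i ≡ g i) → ∑< n f ≡ ∑< n g
  ∑-cong n eq = ∑-cong-< n (λ i _ → eq i)

  ∑-distrib-+ : ∀ n → ∑[ i < n ] (f i + g i) ≡ ∑< n f + ∑< n g
  ∑-distrib-+ zero    = refl
  ∑-distrib-+ (suc n) = trans (cong (_+ (f n + g n)) (∑-distrib-+ n)) (middle-swap (∑< n f) (∑< n g) (f n) (g n))
    where
    middle-swap : ∀ a b c d → (a + b) + (c + d) ≡ (a + c) + (b + d)
    middle-swap = solve-∀ ℚ-ring

module _ {f : ℕ → ℚ} where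

  ∑-zero : ∀ n → (∀ i → i < n → f i ≡ 0ℚ) → ∑< n f ≡ 0ℚ
  ∑-zero n eq = trans (∑-cong-< {g = λ _ → 0ℚ} n eq) (∑-0 n)
    where
    ∑-0 : ∀ n → ∑[ i < n ] 0ℚ ≡ 0ℚ
    ∑-0 zero    = refl
    ∑-0 (suc n) = cong (_+ 0ℚ) (∑-0 n)

  *-distribˡ-∑ : ∀ c n → c * ∑< n f ≡ ∑[ i < n ] c * f i
  *-distribˡ-∑ c zero    = ℚ.*-zeroʳ c
  *-distribˡ-∑ c (suc n) = trans (ℚ.*-distribˡ-+ c (∑< n f) (f n)) (cong (_+ c * f n) (*-distribˡ-∑ c n))

  *-distribʳ-∑ : ∀ c n → ∑< n f * c ≡ ∑[ i < n ] f i * c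
  *-distribʳ-∑ c n = trans (ℚ.*-comm (∑< n f) c) (trans (*-distribˡ-∑ c n) (∑-cong n (λ i → ℚ.*-comm c (f i))))

  ∑-suc : ∀ n → ∑< (suc n) f ≡ f 0 + (∑[ i < n ] f (suc i))
  ∑-suc zero    = ℚ.+-comm 0ℚ (f 0)
  ∑-suc (suc n) = trans (cong (_+ f (suc n)) (∑-suc n)) (ℚ.+-assoc (f 0) _ _)

  ∑-rotate : ∀ n → f 0 ≡ f n → ∑< n f ≡ ∑[ i < n ] f (suc i)
  ∑-rotate zero    _    = refl
  ∑-rotate (suc n) ends = trans (∑-suc n) (trans (cong (_+ ∑< n (f ∘ suc)) ends) (ℚ.+-comm (f (suc n)) _))

  ∑-truncate : ∀ {m n} → m ≤ n → (∀ i → m ≤ i → i < n → f i ≡ 0ℚ) → ∑< n f ≡ ∑< m f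
  ∑-truncate m≤n = go (ℕ.≤⇒≤′ m≤n)
    where
    go : ∀ {m n} → m ℕ.≤′ n → (∀ i → m ≤ i → i < n → f i ≡ 0ℚ) → ∑< n f ≡ ∑< m f
    go ℕ.≤′-refl        _    = refl
    go {m} {suc n} (ℕ.≤′-step m≤′n) vanish = begin
      ∑< n f + f n ≡⟨ cong₂ _+_ (go m≤′n (λ i m≤i i<n → vanish i m≤i (ℕ.m<n⇒m<1+n i<n)))
                                (vanish n (ℕ.≤′⇒≤ m≤′n) ℕ.≤-refl) ⟩
      ∑< m f + 0ℚ  ≡⟨ ℚ.+-identityʳ (∑< m f) ⟩
      ∑< m f       ∎

∑-comm : ∀ m n (f : ℕ → ℕ → ℚ) → ∑[ i < m ] ∑< n (f i) ≡ ∑[ j < n ] ∑[ i < m ] f i j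
∑-comm zero    n f = sym (∑-zero n (λ _ _ → refl))
∑-comm (suc m) n f = trans (cong (_+ ∑< n (f m)) (∑-comm m n f)) (sym (∑-distrib-+ n))

∑-*-∑ : ∀ m n (f g : ℕ → ℚ) → ∑< m f * ∑< n g ≡ ∑[ i < m ] ∑[ j < n ] f i * g j
∑-*-∑ m n f g = trans (*-distribʳ-∑ (∑< n g) m) (∑-cong m (λ i → *-distribˡ-∑ (f i) n))

∑-regroup : ∀ K J T (a b : ℕ → ℚ) (u v : ℕ → ℕ → ℚ) →
  ∑[ k < K ] a k * (∑[ j < J ] b j * (∑[ t < T ] u k t * v j t))
    ≡ ∑[ t < T ] (∑[ k < K ] a k * u k t) * (∑[ j < J ] b j * v j t)
∑-regroup K J T a b u v = begin
  ∑[ k < K ] a k * (∑[ j < J ] b j * (∑[ t < T ] u k t * v j t))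
    ≡⟨ ∑-cong K (λ k → trans (*-distribˡ-∑ (a k) J) (∑-cong J (λ j →
         trans (cong (a k *_) (*-distribˡ-∑ (b j) T)) (*-distribˡ-∑ (a k) T)))) ⟩
  ∑[ k < K ] ∑[ j < J ] ∑[ t < T ] a k * (b j * (u k t * v j t))
    ≡⟨ ∑-cong K (λ k → ∑-comm J T (λ j t → a k * (b j * (u k t * v j t)))) ⟩
  ∑[ k < K ] ∑[ t < T ] ∑[ j < J ] a k * (b j * (u k t * v j t))
    ≡⟨ ∑-comm K T (λ k t → ∑[ j < J ] a k * (b j * (u k t * v j t))) ⟩
  ∑[ t < T ] ∑[ k < K ] ∑[ j < J ] a k * (b j * (u k t * v j t))
    ≡⟨ ∑-cong T (λ t → ∑-cong K (λ k → ∑-cong J (λ j → interchange (a k) (b j) (u k t) (v j t)))) ⟩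
  ∑[ t < T ] ∑[ k < K ] ∑[ j < J ] a k * u k t * (b j * v j t)
    ≡⟨ ∑-cong T (λ t → ∑-*-∑ K J (λ k → a k * u k t) (λ j → b j * v j t)) ⟨
  ∑[ t < T ] (∑[ k < K ] a k * u k t) * (∑[ j < J ] b j * v j t) ∎
  where
  interchange : ∀ a b u v → a * (b * (u * v)) ≡ a * u * (b * v)
  interchange = solve-∀ ℚ-ring

∑-triangle : ∀ m (f : ℕ → ℕ → ℚ) →
  ∑[ i < m ] ∑[ t < suc i ] f i t ≡ ∑[ t < m ] ∑[ j < m ∸ t ] f (t ℕ.+ j) t
∑-triangle zero    f = refl
∑-triangle (suc m) f = begin
  (∑[ i < m ] ∑[ t < suc i ] f i t) + ∑< (suc m) (f m) ≡⟨ cong (_+ ∑< (suc m) (f m)) (∑-triangle m f) ⟩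
  ∑< m g + ∑< (suc m) (f m)                           ≡⟨ cong (_+ ∑< (suc m) (f m)) (sym ∑g) ⟩
  ∑< (suc m) g + ∑< (suc m) (f m)                     ≡⟨ ∑-distrib-+ (suc m) ⟨
  ∑[ t < suc m ] (g t + f m t)                        ≡⟨ ∑-cong-< (suc m) (λ t t<1+m → sym (peel t (ℕ.s≤s⁻¹ t<1+m))) ⟩
  ∑[ t < suc m ] ∑[ j < suc m ∸ t ] f (t ℕ.+ j) t     ∎
  where
  g : ℕ → ℚ
  g t = ∑[ j < m ∸ t ] f (t ℕ.+ j) t
  ∑g : ∑< (suc m) g ≡ ∑< m g
  ∑g rewrite ℕ.n∸n≡0 m = ℚ.+-identityʳ (∑< m g)
  peel : ∀ t → t ≤ m → ∑[ j < suc m ∸ t ] f (t ℕ.+ j) t ≡ g t + f m t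
  peel t t≤m rewrite ℕ.+-∸-assoc 1 t≤m = cong (λ i → g t + f i t) (ℕ.m+[n∸m]≡n t≤m)

∑-convolution : ∀ n (P w : ℕ → ℚ) →
  ∑[ ℓ < suc n ] P ℓ * ∑< (n ∸ ℓ) w ≡ ∑[ k < n ] w k * ∑< (n ∸ k) P
∑-convolution zero    P w = trans (ℚ.+-identityˡ (P 0 * 0ℚ)) (ℚ.*-zeroʳ (P 0))
∑-convolution (suc n) P w = begin
  ∑[ ℓ < suc (suc n) ] P ℓ * ∑< (suc n ∸ ℓ) w         ≡⟨ ∑-suc (suc n) ⟩
  P 0 * ∑< (suc n) w + (∑[ ℓ < suc n ] P (suc ℓ) * ∑< (n ∸ ℓ) w)
    ≡⟨ cong (_+_ (P 0 * ∑< (suc n) w)) (∑-convolution n (P ∘ suc) w) ⟩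
  P 0 * ∑< (suc n) w + ∑< n rest                      ≡⟨ cong (_+_ (P 0 * ∑< (suc n) w)) (sym last-rest) ⟩
  P 0 * ∑< (suc n) w + ∑< (suc n) rest                ≡⟨ cong (_+ ∑< (suc n) rest) (*-distribˡ-∑ (P 0) (suc n)) ⟩
  (∑[ k < suc n ] P 0 * w k) + ∑< (suc n) rest        ≡⟨ ∑-distrib-+ (suc n) ⟨
  ∑[ k < suc n ] (P 0 * w k + rest k)                 ≡⟨ ∑-cong-< (suc n) (λ k k<1+n → sym (split-head k (ℕ.s≤s⁻¹ k<1+n))) ⟩
  ∑[ k < suc n ] w k * ∑< (suc n ∸ k) P               ∎
  where
  rest : ℕ → ℚ
  rest k = w k * ∑< (n ∸ k) (P ∘ suc)
  last-rest : ∑< (suc n) rest ≡ ∑< n rest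
  last-rest rewrite ℕ.n∸n≡0 n = trans (cong (_+_ (∑< n rest)) (ℚ.*-zeroʳ (w n))) (ℚ.+-identityʳ (∑< n rest))
  split-head : ∀ k → k ≤ n → w k * ∑< (suc n ∸ k) P ≡ P 0 * w k + rest k
  split-head k k≤n rewrite ℕ.+-∸-assoc 1 k≤n = begin
    w k * ∑< (suc (n ∸ k)) P                ≡⟨ cong (w k *_) (∑-suc (n ∸ k)) ⟩
    w k * (P 0 + ∑< (n ∸ k) (P ∘ suc))      ≡⟨ ℚ.*-distribˡ-+ (w k) (P 0) (∑< (n ∸ k) (P ∘ suc)) ⟩
    w k * P 0 + rest k                      ≡⟨ cong (_+ rest k) (ℚ.*-comm (w k) (P 0)) ⟩
    P 0 * w k + rest k                      ∎

-- sumFromTo recurses on the length suc b ∸ a, which is stuck for variable a; abstracting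
-- the length with `with` lets it reduce.
sumFromTo-+ : ∀ a k (f : ℕ → ℚ) → sumFromTo a (k ℕ.+ a) f ≡ ∑[ i < suc k ] f (a ℕ.+ i)
sumFromTo-+ a zero f with suc a ∸ a | ℕ.m+n∸n≡m 1 a
... | .1 | refl = refl
sumFromTo-+ a (suc k) f with suc (suc k ℕ.+ a) ∸ a | ℕ.m+n∸n≡m (suc (suc k)) a | sumFromTo-+ a k f
... | .(suc (suc k)) | refl | ih with suc (k ℕ.+ a) ∸ a | ℕ.m+n∸n≡m (suc k) a
...   | .(suc k) | refl = cong (_+ f (a ℕ.+ suc k)) ih

sumFromTo-∑ : ∀ a b (f : ℕ → ℚ) → sumFromTo a b f ≡ ∑[ i < suc b ∸ a ] f (a ℕ.+ i)
sumFromTo-∑ a b f with suc b ∸ a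
... | zero  = refl
... | suc k with suc (k ℕ.+ a) ∸ a | ℕ.m+n∸n≡m (suc k) a | sumFromTo-+ a k f
...   | .(suc k) | refl | eq = eq

toℚᵘ-ℤ→ℚ : ∀ z → ℚ.toℚᵘ (ℤ→ℚ z) ℚᵘ.≃ ℚᵘ.mkℚᵘ z 0
toℚᵘ-ℤ→ℚ z = ℚ.toℚᵘ-fromℚᵘ (ℚᵘ.mkℚᵘ z 0)

ℤ→ℚ-via-ℚᵘ : ∀ {x} z → ℚ.toℚᵘ x ℚᵘ.≃ ℚᵘ.mkℚᵘ z 0 → ℤ→ℚ z ≡ x
ℤ→ℚ-via-ℚᵘ z eq = ℚ.toℚᵘ-injective (ℚᵘ.≃-trans (toℚᵘ-ℤ→ℚ z) (ℚᵘ.≃-sym eq))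

ℤ→ℚ-homo-+ : ∀ a b → ℤ→ℚ (a ℤ.+ b) ≡ ℤ→ℚ a + ℤ→ℚ b
ℤ→ℚ-homo-+ a b = ℤ→ℚ-via-ℚᵘ (a ℤ.+ b) (ℚᵘ.≃-trans (ℚ.toℚᵘ-homo-+ (ℤ→ℚ a) (ℤ→ℚ b))
  (ℚᵘ.≃-trans (ℚᵘ.+-cong (toℚᵘ-ℤ→ℚ a) (toℚᵘ-ℤ→ℚ b)) (ℚᵘ.*≡* (cross-multiplied a b))))
  where
  cross-multiplied : ∀ a b → (a ℤ.* ℤ.+ 1 ℤ.+ b ℤ.* ℤ.+ 1) ℤ.* ℤ.+ 1 ≡ (a ℤ.+ b) ℤ.* (ℤ.+ 1 ℤ.* ℤ.+ 1)
  cross-multiplied = ℤ-Solver.solve-∀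

ℤ→ℚ-homo-* : ∀ a b → ℤ→ℚ (a ℤ.* b) ≡ ℤ→ℚ a * ℤ→ℚ b
ℤ→ℚ-homo-* a b = ℤ→ℚ-via-ℚᵘ (a ℤ.* b) (ℚᵘ.≃-trans (ℚ.toℚᵘ-homo-* (ℤ→ℚ a) (ℤ→ℚ b))
  (ℚᵘ.≃-trans (ℚᵘ.*-cong (toℚᵘ-ℤ→ℚ a) (toℚᵘ-ℤ→ℚ b)) (ℚᵘ.*≡* (cross-multiplied a b))))
  where
  cross-multiplied : ∀ a b → (a ℤ.* b) ℤ.* ℤ.+ 1 ≡ (a ℤ.* b) ℤ.* (ℤ.+ 1 ℤ.* ℤ.+ 1)
  cross-multiplied = ℤ-Solver.solve-∀

ℤ→ℚ-homo-‿- : ∀ a → ℤ→ℚ (ℤ.- a) ≡ - ℤ→ℚ a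
ℤ→ℚ-homo-‿- a = ℤ→ℚ-via-ℚᵘ (ℤ.- a) (ℚᵘ.≃-trans (ℚ.toℚᵘ-homo‿- (ℤ→ℚ a)) (ℚᵘ.-‿cong (toℚᵘ-ℤ→ℚ a)))

ℤ→ℚ-homo-^ : ∀ z k → ℤ→ℚ (z ℤ.^ k) ≡ ℤ→ℚ z ^ℚ k
ℤ→ℚ-homo-^ z zero    = refl
ℤ→ℚ-homo-^ z (suc k) = trans (ℤ→ℚ-homo-* z (z ℤ.^ k)) (cong (ℤ→ℚ z *_) (ℤ→ℚ-homo-^ z k))

ℕ→ℚ-homo-+ : ∀ m n → ℕ→ℚ (m ℕ.+ n) ≡ ℕ→ℚ m + ℕ→ℚ n
ℕ→ℚ-homo-+ m n = trans (cong ℤ→ℚ (ℤ.pos-+ m n)) (ℤ→ℚ-homo-+ (+ m) (+ n))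

ℕ→ℚ-homo-* : ∀ m n → ℕ→ℚ (m ℕ.* n) ≡ ℕ→ℚ m * ℕ→ℚ n
ℕ→ℚ-homo-* m n = trans (cong ℤ→ℚ (ℤ.pos-* m n)) (ℤ→ℚ-homo-* (+ m) (+ n))

ℕ→ℚ-homo-^ : ∀ m k → ℕ→ℚ (m ^ k) ≡ ℕ→ℚ m ^ℚ k
ℕ→ℚ-homo-^ m zero    = refl
ℕ→ℚ-homo-^ m (suc k) = trans (ℕ→ℚ-homo-* m (m ^ k)) (cong (ℕ→ℚ m *_) (ℕ→ℚ-homo-^ m k))

∑-foldr : ∀ n (f : ℕ → ℚ) → Vector.foldr _+_ 0ℚ (λ (i : Fin n) → f (toℕ i)) ≡ ∑< n f
∑-foldr zero    f = refl
∑-foldr (suc n) f = trans (cong (_+_ (f 0)) (∑-foldr n (f ∘ suc))) (sym (∑-suc n))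

binomial-theorem : ∀ x y n → (x + y) ^ℚ n ≡ ∑[ t < suc n ] ℕ→ℚ (n C t) * (x ^ℚ t * y ^ℚ (n ∸ t))
binomial-theorem x y n = trans (Binomial.theorem n x y)
  (trans (∑-foldr (suc n) _) (∑-cong (suc n) (λ t → ×-ℕ→ℚ (n C t) (x ^ℚ t * y ^ℚ (n ∸ t)))))
  where
  ×-ℕ→ℚ : ∀ m x → m × x ≡ ℕ→ℚ m * x
  ×-ℕ→ℚ zero    x = sym (ℚ.*-zeroˡ x)
  ×-ℕ→ℚ (suc m) x = begin
    x + m × x                 ≡⟨ cong (_+_ x) (×-ℕ→ℚ m x) ⟩
    x + ℕ→ℚ m * x             ≡⟨ cong (_+ ℕ→ℚ m * x) (ℚ.*-identityˡ x) ⟨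
    1ℚ * x + ℕ→ℚ m * x        ≡⟨ ℚ.*-distribʳ-+ x 1ℚ (ℕ→ℚ m) ⟨
    (1ℚ + ℕ→ℚ m) * x          ≡⟨ cong (_* x) (ℕ→ℚ-homo-+ 1 m) ⟨
    ℕ→ℚ (suc m) * x           ∎

n*nCk≡k*nCk+[k+1]*nC[k+1] : ∀ n k → n ℕ.* (n C k) ≡ k ℕ.* (n C k) ℕ.+ suc k ℕ.* (n C suc k)
n*nCk≡k*nCk+[k+1]*nC[k+1] zero    zero    = refl
n*nCk≡k*nCk+[k+1]*nC[k+1] zero    (suc k) = sym (cong₂ ℕ._+_ (ℕ.*-zeroʳ (suc k)) (ℕ.*-zeroʳ (suc (suc k))))
n*nCk≡k*nCk+[k+1]*nC[k+1] (suc n) zero    = trans (ℕ.*-identityʳ (suc n)) (sym (trans (ℕ.+-identityʳ _) (nC1≡n (suc n))))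
n*nCk≡k*nCk+[k+1]*nC[k+1] (suc n) (suc k) = begin
  suc n ℕ.* (suc n C suc k)
    ≡⟨ cong (suc n ℕ.*_) (pascal k) ⟨
  suc n ℕ.* (n C k ℕ.+ n C suc k)
    ≡⟨ distribute n (n C k) (n C suc k) ⟩
  n ℕ.* (n C k) ℕ.+ n ℕ.* (n C suc k) ℕ.+ n C k ℕ.+ n C suc k
    ≡⟨ cong₂ (λ a b → a ℕ.+ b ℕ.+ n C k ℕ.+ n C suc k)
             (n*nCk≡k*nCk+[k+1]*nC[k+1] n k) (n*nCk≡k*nCk+[k+1]*nC[k+1] n (suc k)) ⟩
  k ℕ.* (n C k) ℕ.+ suc k ℕ.* (n C suc k) ℕ.+ (suc k ℕ.* (n C suc k) ℕ.+ suc (suc k) ℕ.* (n C suc (suc k)))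
    ℕ.+ n C k ℕ.+ n C suc k
    ≡⟨ regroup k (n C k) (n C suc k) (n C suc (suc k)) ⟩
  suc k ℕ.* (n C k ℕ.+ n C suc k) ℕ.+ suc (suc k) ℕ.* (n C suc k ℕ.+ n C suc (suc k))
    ≡⟨ cong₂ (λ a b → suc k ℕ.* a ℕ.+ suc (suc k) ℕ.* b) (pascal k) (pascal (suc k)) ⟩
  suc k ℕ.* (suc n C suc k) ℕ.+ suc (suc k) ℕ.* (suc n C suc (suc k)) ∎
  where
  pascal : ∀ k → n C k ℕ.+ n C suc k ≡ suc n C suc k
  pascal = nCk+nC[k+1]≡[n+1]C[k+1] n
  distribute : ∀ n a b → (1 ℕ.+ n) ℕ.* (a ℕ.+ b) ≡ n ℕ.* a ℕ.+ n ℕ.* b ℕ.+ a ℕ.+ b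
  distribute = ℕ-Solver.solve-∀
  regroup : ∀ k a b c → k ℕ.* a ℕ.+ (1 ℕ.+ k) ℕ.* b ℕ.+ ((1 ℕ.+ k) ℕ.* b ℕ.+ (2 ℕ.+ k) ℕ.* c) ℕ.+ a ℕ.+ b
                        ≡ (1 ℕ.+ k) ℕ.* (a ℕ.+ b) ℕ.+ (2 ℕ.+ k) ℕ.* (b ℕ.+ c)
  regroup = ℕ-Solver.solve-∀

ℕ→ℚ-absorption : ∀ m k → ℕ→ℚ m * ℕ→ℚ (m C k) ≡ ℕ→ℚ k * ℕ→ℚ (m C k) + ℕ→ℚ (suc k) * ℕ→ℚ (m C suc k)
ℕ→ℚ-absorption m k = begin
  ℕ→ℚ m * ℕ→ℚ (m C k)                                      ≡⟨ ℕ→ℚ-homo-* m (m C k) ⟨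
  ℕ→ℚ (m ℕ.* (m C k))                                      ≡⟨ cong ℕ→ℚ (n*nCk≡k*nCk+[k+1]*nC[k+1] m k) ⟩
  ℕ→ℚ (k ℕ.* (m C k) ℕ.+ suc k ℕ.* (m C suc k))            ≡⟨ ℕ→ℚ-homo-+ (k ℕ.* (m C k)) (suc k ℕ.* (m C suc k)) ⟩
  ℕ→ℚ (k ℕ.* (m C k)) + ℕ→ℚ (suc k ℕ.* (m C suc k))
    ≡⟨ cong₂ _+_ (ℕ→ℚ-homo-* k (m C k)) (ℕ→ℚ-homo-* (suc k) (m C suc k)) ⟩
  ℕ→ℚ k * ℕ→ℚ (m C k) + ℕ→ℚ (suc k) * ℕ→ℚ (m C suc k)     ∎

∑-C : ∀ M k → ∑[ x < M ] ℕ→ℚ (x C k) ≡ ℕ→ℚ (M C suc k)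
∑-C zero    k = refl
∑-C (suc M) k = begin
  (∑[ x < M ] ℕ→ℚ (x C k)) + ℕ→ℚ (M C k) ≡⟨ cong (_+ ℕ→ℚ (M C k)) (∑-C M k) ⟩
  ℕ→ℚ (M C suc k) + ℕ→ℚ (M C k)         ≡⟨ ℚ.+-comm (ℕ→ℚ (M C suc k)) (ℕ→ℚ (M C k)) ⟩
  ℕ→ℚ (M C k) + ℕ→ℚ (M C suc k)         ≡⟨ ℕ→ℚ-homo-+ (M C k) (M C suc k) ⟨
  ℕ→ℚ (M C k ℕ.+ M C suc k)             ≡⟨ cong ℕ→ℚ (nCk+nC[k+1]≡[n+1]C[k+1] M k) ⟩
  ℕ→ℚ (suc M C suc k)                   ∎

k>p⇒S₂pk≡0 : ∀ {p k} → k ℕ.> p → S₂ p k ≡ 0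
k>p⇒S₂pk≡0 {zero}  {suc k} _         = refl
k>p⇒S₂pk≡0 {suc p} {suc k} (s≤s k>p)
  rewrite k>p⇒S₂pk≡0 k>p | k>p⇒S₂pk≡0 (ℕ.m<n⇒m<1+n k>p) = trans (ℕ.+-identityʳ (suc k ℕ.* 0)) (ℕ.*-zeroʳ (suc k))

S₂!-rec : ∀ p k → ℕ→ℚ (S₂ (suc p) (suc k) ℕ.* suc k !)
                  ≡ ℕ→ℚ (suc k) * ℕ→ℚ (S₂ p (suc k) ℕ.* suc k !) + ℕ→ℚ (suc k) * ℕ→ℚ (S₂ p k ℕ.* k !)
S₂!-rec p k = begin
  ℕ→ℚ (S₂ (suc p) (suc k) ℕ.* suc k !)
    ≡⟨ cong ℕ→ℚ (distribute (suc k) (S₂ p (suc k)) (S₂ p k) (k !)) ⟩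
  ℕ→ℚ (suc k ℕ.* (S₂ p (suc k) ℕ.* suc k !) ℕ.+ suc k ℕ.* (S₂ p k ℕ.* k !))
    ≡⟨ ℕ→ℚ-homo-+ (suc k ℕ.* (S₂ p (suc k) ℕ.* suc k !)) (suc k ℕ.* (S₂ p k ℕ.* k !)) ⟩
  ℕ→ℚ (suc k ℕ.* (S₂ p (suc k) ℕ.* suc k !)) + ℕ→ℚ (suc k ℕ.* (S₂ p k ℕ.* k !))
    ≡⟨ cong₂ _+_ (ℕ→ℚ-homo-* (suc k) (S₂ p (suc k) ℕ.* suc k !)) (ℕ→ℚ-homo-* (suc k) (S₂ p k ℕ.* k !)) ⟩
  ℕ→ℚ (suc k) * ℕ→ℚ (S₂ p (suc k) ℕ.* suc k !) + ℕ→ℚ (suc k) * ℕ→ℚ (S₂ p k ℕ.* k !) ∎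
  where
  distribute : ∀ K a b f → (K ℕ.* a ℕ.+ b) ℕ.* (K ℕ.* f) ≡ K ℕ.* (a ℕ.* (K ℕ.* f)) ℕ.+ K ℕ.* (b ℕ.* f)
  distribute = ℕ-Solver.solve-∀

^-as-∑-S₂ : ∀ p x → ℕ→ℚ (x ^ p) ≡ ∑[ k < suc p ] ℕ→ℚ (S₂ p k ℕ.* k !) * ℕ→ℚ (x C k)
^-as-∑-S₂ zero    x = refl
^-as-∑-S₂ (suc p) x = begin
  ℕ→ℚ (x ℕ.* x ^ p)                         ≡⟨ ℕ→ℚ-homo-* x (x ^ p) ⟩
  X * ℕ→ℚ (x ^ p)                           ≡⟨ cong (X *_) (^-as-∑-S₂ p x) ⟩
  X * (∑[ k < suc p ] a k * B k)            ≡⟨ *-distribˡ-∑ X (suc p) ⟩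
  ∑[ k < suc p ] X * (a k * B k)            ≡⟨ ∑-cong (suc p) split ⟩
  ∑[ k < suc p ] (g k + h k)                ≡⟨ ∑-distrib-+ (suc p) ⟩
  ∑< (suc p) g + ∑< (suc p) h               ≡⟨ cong (_+ ∑< (suc p) h) (∑-rotate (suc p) (trans g[0]≡0 (sym g[1+p]≡0))) ⟩
  ∑< (suc p) (g ∘ suc) + ∑< (suc p) h       ≡⟨ ∑-distrib-+ (suc p) ⟨
  ∑[ k < suc p ] (g (suc k) + h k)          ≡⟨ ∑-cong (suc p) merge ⟩
  ∑[ k < suc p ] a′ (suc k) * B (suc k)     ≡⟨ ℚ.+-identityˡ _ ⟨
  0ℚ + (∑[ k < suc p ] a′ (suc k) * B (suc k)) ≡⟨ cong (_+ (∑[ k < suc p ] a′ (suc k) * B (suc k))) (ℚ.*-zeroˡ (B 0)) ⟨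
  a′ 0 * B 0 + (∑[ k < suc p ] a′ (suc k) * B (suc k)) ≡⟨ ∑-suc (suc p) ⟨
  ∑[ k < suc (suc p) ] a′ k * B k           ∎
  where
  X = ℕ→ℚ x
  a a′ B g h : ℕ → ℚ
  a  k = ℕ→ℚ (S₂ p k ℕ.* k !)
  a′ k = ℕ→ℚ (S₂ (suc p) k ℕ.* k !)
  B  k = ℕ→ℚ (x C k)
  g  k = a k * (ℕ→ℚ k * B k)
  h  k = a k * (ℕ→ℚ (suc k) * B (suc k))
  swap : ∀ a b c → a * (b * c) ≡ b * (a * c)
  swap = solve-∀ ℚ-ring
  collect : ∀ a₁ a₀ K B → a₁ * (K * B) + a₀ * (K * B) ≡ (K * a₁ + K * a₀) * B
  collect = solve-∀ ℚ-ring
  split : ∀ k → X * (a k * B k) ≡ g k + h k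
  split k = trans (swap X (a k) (B k))
                  (trans (cong (a k *_) (ℕ→ℚ-absorption x k)) (ℚ.*-distribˡ-+ (a k) _ _))
  merge : ∀ k → g (suc k) + h k ≡ a′ (suc k) * B (suc k)
  merge k = trans (collect (a (suc k)) (a k) (ℕ→ℚ (suc k)) (B (suc k))) (cong (_* B (suc k)) (sym (S₂!-rec p k)))
  g[0]≡0 : g 0 ≡ 0ℚ
  g[0]≡0 = trans (cong (a 0 *_) (ℚ.*-zeroˡ (B 0))) (ℚ.*-zeroʳ (a 0))
  g[1+p]≡0 : g (suc p) ≡ 0ℚ
  g[1+p]≡0 rewrite k>p⇒S₂pk≡0 (ℕ.n<1+n p) = ℚ.*-zeroˡ (ℕ→ℚ (suc p) * B (suc p))

∑-^-S₂ : ∀ p M → ∑[ x < M ] ℕ→ℚ (x ^ suc p)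
                  ≡ ∑[ j < suc p ] ℕ→ℚ (S₂ (suc p) (suc j) ℕ.* suc j !) * ℕ→ℚ (M C suc (suc j))
∑-^-S₂ p M = begin
  ∑[ x < M ] ℕ→ℚ (x ^ suc p)                                  ≡⟨ ∑-cong M (^-as-∑-S₂ (suc p)) ⟩
  ∑[ x < M ] ∑[ k < suc (suc p) ] a k * ℕ→ℚ (x C k)           ≡⟨ ∑-comm M (suc (suc p)) (λ x k → a k * ℕ→ℚ (x C k)) ⟩
  ∑[ k < suc (suc p) ] ∑[ x < M ] a k * ℕ→ℚ (x C k)           ≡⟨ ∑-cong (suc (suc p)) (λ k → *-distribˡ-∑ (a k) M) ⟨
  ∑[ k < suc (suc p) ] a k * (∑[ x < M ] ℕ→ℚ (x C k))         ≡⟨ ∑-cong (suc (suc p)) (λ k → cong (a k *_) (∑-C M k)) ⟩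
  ∑[ k < suc (suc p) ] a k * ℕ→ℚ (M C suc k)                  ≡⟨ ∑-suc (suc p) ⟩
  a 0 * ℕ→ℚ (M C 1) + (∑[ j < suc p ] a (suc j) * ℕ→ℚ (M C suc (suc j)))
    ≡⟨ cong (_+ (∑[ j < suc p ] a (suc j) * ℕ→ℚ (M C suc (suc j)))) (ℚ.*-zeroˡ (ℕ→ℚ (M C 1))) ⟩
  0ℚ + (∑[ j < suc p ] a (suc j) * ℕ→ℚ (M C suc (suc j)))     ≡⟨ ℚ.+-identityˡ _ ⟩
  ∑[ j < suc p ] a (suc j) * ℕ→ℚ (M C suc (suc j))            ∎
  where
  a : ℕ → ℚ
  a k = ℕ→ℚ (S₂ (suc p) k ℕ.* k !)

ℤ→ℚ-homo-- : ∀ a b → ℤ→ℚ (a ℤ.- b) ≡ ℤ→ℚ a ℚ.- ℤ→ℚ b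
ℤ→ℚ-homo-- a b = trans (ℤ→ℚ-homo-+ a (ℤ.- b)) (cong (_+_ (ℤ→ℚ a)) (ℤ→ℚ-homo-‿- b))

k>n⇒s₁nk≡0 : ∀ {n k} → k ℕ.> n → s₁ n k ≡ + 0
k>n⇒s₁nk≡0 {zero}  {suc k} _         = refl
k>n⇒s₁nk≡0 {suc n} {suc k} (s≤s k>n)
  rewrite k>n⇒s₁nk≡0 k>n | k>n⇒s₁nk≡0 (ℕ.m<n⇒m<1+n k>n) | ℤ.*-zeroʳ (+ n) = refl

falling : ℚ → ℕ → ℚ
falling x zero    = 1ℚ
falling x (suc k) = (x ℚ.- ℕ→ℚ k) * falling x k

falling-s₁ : ∀ x k → falling x k ≡ ∑[ i < suc k ] ℤ→ℚ (s₁ k i) * x ^ℚ i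
falling-s₁ x zero    = refl
falling-s₁ x (suc k) = sym (begin
  ∑[ i < suc (suc k) ] G i                                 ≡⟨ ∑-suc (suc k) ⟩
  G 0 + (∑[ i < suc k ] G (suc i))                         ≡⟨ cong₂ _+_ G0 (∑-cong (suc k) G[1+i]) ⟩
  - (K * F 0) + (∑[ i < suc k ] (x * F i + - K * F (suc i))) ≡⟨ cong (_+_ (- (K * F 0))) (∑-distrib-+ (suc k)) ⟩
  - (K * F 0) + ((∑[ i < suc k ] x * F i) + (∑[ i < suc k ] - K * F (suc i)))
    ≡⟨ cong₂ (λ a b → - (K * F 0) + (a + b)) (*-distribˡ-∑ x (suc k)) (*-distribˡ-∑ (- K) (suc k)) ⟨
  - (K * F 0) + (x * ∑< (suc k) F + - K * T)               ≡⟨ cong (λ S → - (K * F 0) + (x * S + - K * T)) S≡F0+T ⟩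
  - (K * F 0) + (x * (F 0 + T) + - K * T)                  ≡⟨ regroup K (F 0) x T ⟩
  (x ℚ.- K) * (F 0 + T)                                    ≡⟨ cong ((x ℚ.- K) *_) S≡F0+T ⟨
  (x ℚ.- K) * ∑< (suc k) F                                 ≡⟨ cong ((x ℚ.- K) *_) (falling-s₁ x k) ⟨
  (x ℚ.- K) * falling x k                                  ∎)
  where
  neg-assoc : ∀ K s → - (K * s) * 1ℚ ≡ - (K * (s * 1ℚ))
  neg-assoc = solve-∀ ℚ-ring
  expand : ∀ a b K x P → (a ℚ.- K * b) * (x * P) ≡ x * (a * P) + - K * (b * (x * P))
  expand = solve-∀ ℚ-ring
  regroup : ∀ K F₀ x T → - (K * F₀) + (x * (F₀ + T) + - K * T) ≡ (x ℚ.- K) * (F₀ + T)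
  regroup = solve-∀ ℚ-ring
  K = ℕ→ℚ k
  F G : ℕ → ℚ
  F i = ℤ→ℚ (s₁ k i) * x ^ℚ i
  G i = ℤ→ℚ (s₁ (suc k) i) * x ^ℚ i
  T = ∑[ i < suc k ] F (suc i)
  F[1+k]≡0 : F (suc k) ≡ 0ℚ
  F[1+k]≡0 = trans (cong (λ s → ℤ→ℚ s * x ^ℚ suc k) (k>n⇒s₁nk≡0 (ℕ.n<1+n k))) (ℚ.*-zeroˡ (x ^ℚ suc k))
  S≡F0+T : ∑< (suc k) F ≡ F 0 + T
  S≡F0+T = begin
    ∑< (suc k) F                ≡⟨ ℚ.+-identityʳ _ ⟨
    ∑< (suc k) F + 0ℚ           ≡⟨ cong (_+_ (∑< (suc k) F)) (sym F[1+k]≡0) ⟩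
    ∑< (suc (suc k)) F          ≡⟨ ∑-suc (suc k) ⟩
    F 0 + T                     ∎
  G0 : G 0 ≡ - (K * F 0)
  G0 = trans (cong (_* 1ℚ) (trans (ℤ→ℚ-homo-‿- (+ k ℤ.* s₁ k 0)) (cong -_ (ℤ→ℚ-homo-* (+ k) (s₁ k 0)))))
             (neg-assoc K (ℤ→ℚ (s₁ k 0)))
  G[1+i] : ∀ i → G (suc i) ≡ x * F i + - K * F (suc i)
  G[1+i] i = trans (cong (_* (x * x ^ℚ i)) (trans (ℤ→ℚ-homo-- (s₁ k i) (+ k ℤ.* s₁ k (suc i)))
                                                  (cong (ℚ._-_ (ℤ→ℚ (s₁ k i))) (ℤ→ℚ-homo-* (+ k) (s₁ k (suc i))))))
                   (expand (ℤ→ℚ (s₁ k i)) (ℤ→ℚ (s₁ k (suc i))) K x (x ^ℚ i))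

falling-C : ∀ m k → falling (ℕ→ℚ m) k ≡ ℕ→ℚ (k !) * ℕ→ℚ (m C k)
falling-C m zero    = refl
falling-C m (suc k) = begin
  (M ℚ.- K) * falling M k           ≡⟨ cong ((M ℚ.- K) *_) (falling-C m k) ⟩
  (M ℚ.- K) * (Fk * B)              ≡⟨ factor-out M K Fk B ⟩
  Fk * (M * B ℚ.- K * B)            ≡⟨ cong (λ z → Fk * (z ℚ.- K * B)) (ℕ→ℚ-absorption m k) ⟩
  Fk * (K * B + K₁ * B′ ℚ.- K * B)  ≡⟨ cancel Fk K B K₁ B′ ⟩
  K₁ * Fk * B′                      ≡⟨ cong (_* B′) (ℕ→ℚ-homo-* (suc k) (k !)) ⟨
  ℕ→ℚ (suc k !) * B′                ∎
  where
  factor-out : ∀ M K F B → (M ℚ.- K) * (F * B) ≡ F * (M * B ℚ.- K * B)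
  factor-out = solve-∀ ℚ-ring
  cancel : ∀ F K B K₁ B′ → F * (K * B + K₁ * B′ ℚ.- K * B) ≡ K₁ * F * B′
  cancel = solve-∀ ℚ-ring
  M = ℕ→ℚ m
  K = ℕ→ℚ k
  K₁ = ℕ→ℚ (suc k)
  Fk = ℕ→ℚ (k !)
  B = ℕ→ℚ (m C k)
  B′ = ℕ→ℚ (m C suc k)

1/n*n≡1 : ∀ n .{{_ : ℕ.NonZero n}} → (+ 1 ℚ./ n) * ℕ→ℚ n ≡ 1ℚ
1/n*n≡1 (suc n) = ℚ.toℚᵘ-injective (ℚᵘ.≃-trans (ℚ.toℚᵘ-homo-* (+ 1 ℚ./ suc n) (ℕ→ℚ (suc n)))
  (ℚᵘ.≃-trans (ℚᵘ.*-cong (ℚ.toℚᵘ-fromℚᵘ (ℚᵘ.mkℚᵘ (+ 1) n)) (toℚᵘ-ℤ→ℚ (+ suc n)))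
              (ℚᵘ.*-inverseˡ (ℚᵘ.mkℚᵘ (+ suc n) 0))))

1/! : ℕ → ℚ
1/! k = ℚ._/_ (+ 1) (k !) {{k ℕ.!≢0}}

C-as-∑-s₁ : ∀ m k → ℕ→ℚ (m C k) ≡ 1/! k * (∑[ i < suc k ] ℤ→ℚ (s₁ k i) * ℕ→ℚ m ^ℚ i)
C-as-∑-s₁ m k = begin
  ℕ→ℚ (m C k)                                ≡⟨ ℚ.*-identityˡ _ ⟨
  1ℚ * ℕ→ℚ (m C k)                           ≡⟨ cong (_* ℕ→ℚ (m C k)) (1/n*n≡1 (k !) {{k ℕ.!≢0}}) ⟨
  d * ℕ→ℚ (k !) * ℕ→ℚ (m C k)                ≡⟨ ℚ.*-assoc d _ _ ⟩
  d * (ℕ→ℚ (k !) * ℕ→ℚ (m C k))              ≡⟨ cong (d *_) (falling-C m k) ⟨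
  d * falling (ℕ→ℚ m) k                      ≡⟨ cong (d *_) (falling-s₁ (ℕ→ℚ m) k) ⟩
  d * (∑[ i < suc k ] ℤ→ℚ (s₁ k i) * ℕ→ℚ m ^ℚ i) ∎
  where
  d = 1/! k

powℤ-*-suc : ∀ k e → powℤ k e * ℕ→ℚ (suc k) ≡ powℤ k (e ℤ.+ + 1)
powℤ-*-suc k (+ m) = begin
  ℕ→ℚ (suc k ^ m) * ℕ→ℚ (suc k)   ≡⟨ ℕ→ℚ-homo-* (suc k ^ m) (suc k) ⟨
  ℕ→ℚ (suc k ^ m ℕ.* suc k)       ≡⟨ cong (λ z → ℕ→ℚ (suc k ^ m ℕ.* z)) (ℕ.^-identityʳ (suc k)) ⟨
  ℕ→ℚ (suc k ^ m ℕ.* suc k ^ 1)   ≡⟨ cong ℕ→ℚ (ℕ.^-distribˡ-+-* (suc k) m 1) ⟨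
  ℕ→ℚ (suc k ^ (m ℕ.+ 1))         ∎
powℤ-*-suc k -[1+ zero ] =
  trans (cong (powℤ k -[1+ 0 ] *_) (cong ℕ→ℚ (sym (ℕ.^-identityʳ (suc k))))) (1/n*n≡1 (suc k ^ 1) {{ℕ.m^n≢0 (suc k) 1}})
powℤ-*-suc k -[1+ suc m ] = begin
  B * J                ≡⟨ ℚ.*-identityʳ (B * J) ⟨
  B * J * 1ℚ           ≡⟨ cong (B * J *_) (1/n*n≡1 (suc k ^ suc m) {{ℕ.m^n≢0 (suc k) (suc m)}}) ⟨
  B * J * (A * P)      ≡⟨ rearrange B J A P ⟩
  A * (B * (J * P))    ≡⟨ cong (λ z → A * (B * z)) (ℕ→ℚ-homo-* (suc k) (suc k ^ suc m)) ⟨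
  A * (B * ℕ→ℚ (suc k ^ suc (suc m))) ≡⟨ cong (A *_) (1/n*n≡1 (suc k ^ suc (suc m)) {{ℕ.m^n≢0 (suc k) (suc (suc m))}}) ⟩
  A * 1ℚ               ≡⟨ ℚ.*-identityʳ A ⟩
  A                    ∎
  where
  rearrange : ∀ B J A P → B * J * (A * P) ≡ A * (B * (J * P))
  rearrange = solve-∀ ℚ-ring
  J = ℕ→ℚ (suc k)
  P = ℕ→ℚ (suc k ^ suc m)
  A = powℤ k -[1+ m ]
  B = powℤ k -[1+ suc m ]

powℤ-*-^ : ∀ k e t → powℤ k e * ℕ→ℚ (suc k) ^ℚ t ≡ powℤ k (e ℤ.+ + t)
powℤ-*-^ k e zero    = trans (ℚ.*-identityʳ (powℤ k e)) (cong (powℤ k) (sym (ℤ.+-identityʳ e)))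
powℤ-*-^ k e (suc t) = begin
  powℤ k e * (J * J ^ℚ t)          ≡⟨ rearrange (powℤ k e) J (J ^ℚ t) ⟩
  powℤ k e * J ^ℚ t * J            ≡⟨ cong (_* J) (powℤ-*-^ k e t) ⟩
  powℤ k (e ℤ.+ + t) * J           ≡⟨ powℤ-*-suc k (e ℤ.+ + t) ⟩
  powℤ k (e ℤ.+ + t ℤ.+ + 1)       ≡⟨ cong (powℤ k) (trans (ℤ.+-assoc e (+ t) (+ 1)) (cong (ℤ._+_ e) (ℤ.+-comm (+ t) (+ 1)))) ⟩
  powℤ k (e ℤ.+ + suc t)           ∎
  where
  rearrange : ∀ w J P → w * (J * P) ≡ w * P * J
  rearrange = solve-∀ ℚ-ring
  J = ℕ→ℚ (suc k)

H-as-∑ : ∀ N m → H N m ≡ ∑[ k < N ] powℤ k (ℤ.- m)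
H-as-∑ N m = sumFromTo-∑ 1 N (λ j → powℤ (j ∸ 1) (ℤ.- m))

H-shift : ∀ N r t → ∑[ k < N ] powℤ k (ℤ.- + r) * ℕ→ℚ (suc k) ^ℚ t ≡ H N (+ r - + t)
H-shift N r t = trans (∑-cong N (λ k → trans (powℤ-*-^ k (ℤ.- + r) t) (cong (powℤ k) (negate (+ r) (+ t)))))
                      (sym (H-as-∑ N (+ r - + t)))
  where
  negate : ∀ a b → ℤ.- a ℤ.+ b ≡ ℤ.- (a - b)
  negate = ℤ-Solver.solve-∀

a₆-summand : ℕ → ℕ → ℕ → ℕ → ℚ
a₆-summand ℓ n t i = ℤ→ℚ (s₁ (suc ℓ) i) * ℕ→ℚ (i C t) * (- 1ℚ) ^ℚ t * ℕ→ℚ (suc n) ^ℚ (i ∸ t)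

a₆-as-∑ : ∀ ℓ n t → a₆ ℓ n t ≡ 1/! (suc ℓ) * (∑[ j < suc (suc ℓ) ∸ t ] a₆-summand ℓ n t (t ℕ.+ j))
a₆-as-∑ ℓ n t = cong (1/! (suc ℓ) *_) (trans (sumFromTo-∑ t (suc ℓ) _) (∑-cong (suc (suc ℓ) ∸ t) (λ j → cast (t ℕ.+ j))))
  where
  cast : ∀ i → ℤ→ℚ (s₁ (suc ℓ) i ℤ.* + (i C t) ℤ.* (ℤ.- + 1) ℤ.^ t ℤ.* + (suc n ^ (i ∸ t))) ≡ a₆-summand ℓ n t i
  cast i = begin
    ℤ→ℚ (s₁ (suc ℓ) i ℤ.* + (i C t) ℤ.* (ℤ.- + 1) ℤ.^ t ℤ.* + (suc n ^ (i ∸ t)))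
      ≡⟨ ℤ→ℚ-homo-* (s₁ (suc ℓ) i ℤ.* + (i C t) ℤ.* (ℤ.- + 1) ℤ.^ t) (+ (suc n ^ (i ∸ t))) ⟩
    ℤ→ℚ (s₁ (suc ℓ) i ℤ.* + (i C t) ℤ.* (ℤ.- + 1) ℤ.^ t) * ℕ→ℚ (suc n ^ (i ∸ t))
      ≡⟨ cong₂ _*_ (ℤ→ℚ-homo-* (s₁ (suc ℓ) i ℤ.* + (i C t)) ((ℤ.- + 1) ℤ.^ t)) (ℕ→ℚ-homo-^ (suc n) (i ∸ t)) ⟩
    ℤ→ℚ (s₁ (suc ℓ) i ℤ.* + (i C t)) * ℤ→ℚ ((ℤ.- + 1) ℤ.^ t) * ℕ→ℚ (suc n) ^ℚ (i ∸ t)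
      ≡⟨ cong₂ (λ a b → a * b * ℕ→ℚ (suc n) ^ℚ (i ∸ t)) (ℤ→ℚ-homo-* (s₁ (suc ℓ) i) (+ (i C t))) (ℤ→ℚ-homo-^ (ℤ.- + 1) t) ⟩
    ℤ→ℚ (s₁ (suc ℓ) i) * ℕ→ℚ (i C t) * (- 1ℚ) ^ℚ t * ℕ→ℚ (suc n) ^ℚ (i ∸ t) ∎

a₆-vanishes : ∀ ℓ n t → suc (suc ℓ) ≤ t → a₆ ℓ n t ≡ 0ℚ
a₆-vanishes ℓ n t ℓ+2≤t rewrite a₆-as-∑ ℓ n t | ℕ.m≤n⇒m∸n≡0 ℓ+2≤t = ℚ.*-zeroʳ (1/! (suc ℓ))

ℕ→ℚ-∸ : ∀ {n k} → k < n → ℕ→ℚ (n ∸ k) ≡ - 1ℚ * ℕ→ℚ (suc k) + ℕ→ℚ (suc n)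
ℕ→ℚ-∸ {n} {k} k<n = begin
  m                                   ≡⟨ cancel m u ⟩
  - 1ℚ * u + (m + u)                  ≡⟨ cong (_+_ (- 1ℚ * u)) (ℕ→ℚ-homo-+ (n ∸ k) (suc k)) ⟨
  - 1ℚ * u + ℕ→ℚ (n ∸ k ℕ.+ suc k)    ≡⟨ cong (λ z → - 1ℚ * u + ℕ→ℚ z) (trans (ℕ.+-suc (n ∸ k) k) (cong suc (ℕ.m∸n+n≡m (ℕ.<⇒≤ k<n)))) ⟩
  - 1ℚ * u + ℕ→ℚ (suc n)              ∎
  where
  cancel : ∀ m u → m ≡ - 1ℚ * u + (m + u)
  cancel = solve-∀ ℚ-ring
  m = ℕ→ℚ (n ∸ k)
  u = ℕ→ℚ (suc k)

s₁-*-binomial : ∀ {n k} ℓ i → k < n →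
  ℤ→ℚ (s₁ (suc ℓ) i) * ℕ→ℚ (n ∸ k) ^ℚ i ≡ ∑[ t < suc i ] ℕ→ℚ (suc k) ^ℚ t * a₆-summand ℓ n t i
s₁-*-binomial {n} {k} ℓ i k<n = begin
  σ * ℕ→ℚ (n ∸ k) ^ℚ i
    ≡⟨ cong (λ z → σ * z ^ℚ i) (ℕ→ℚ-∸ k<n) ⟩
  σ * (- 1ℚ * u + N) ^ℚ i
    ≡⟨ cong (σ *_) (binomial-theorem (- 1ℚ * u) N i) ⟩
  σ * (∑[ t < suc i ] ℕ→ℚ (i C t) * ((- 1ℚ * u) ^ℚ t * N ^ℚ (i ∸ t)))
    ≡⟨ *-distribˡ-∑ σ (suc i) ⟩
  ∑[ t < suc i ] σ * (ℕ→ℚ (i C t) * ((- 1ℚ * u) ^ℚ t * N ^ℚ (i ∸ t)))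
    ≡⟨ ∑-cong (suc i) (λ t → cong (λ z → σ * (ℕ→ℚ (i C t) * (z * N ^ℚ (i ∸ t)))) (^-distrib-* (- 1ℚ) u t)) ⟩
  ∑[ t < suc i ] σ * (ℕ→ℚ (i C t) * ((- 1ℚ) ^ℚ t * u ^ℚ t * N ^ℚ (i ∸ t)))
    ≡⟨ ∑-cong (suc i) (λ t → rearrange σ (ℕ→ℚ (i C t)) ((- 1ℚ) ^ℚ t) (u ^ℚ t) (N ^ℚ (i ∸ t))) ⟩
  ∑[ t < suc i ] u ^ℚ t * a₆-summand ℓ n t i ∎
  where
  rearrange : ∀ s c e U P → s * (c * (e * U * P)) ≡ U * (s * c * e * P)
  rearrange = solve-∀ ℚ-ring
  σ = ℤ→ℚ (s₁ (suc ℓ) i)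
  u = ℕ→ℚ (suc k)
  N = ℕ→ℚ (suc n)

C-as-∑-a₆ : ∀ {n k} ℓ T → k < n → suc (suc ℓ) ≤ T →
  ℕ→ℚ ((n ∸ k) C suc ℓ) ≡ ∑[ t < T ] ℕ→ℚ (suc k) ^ℚ t * a₆ ℓ n t
C-as-∑-a₆ {n} {k} ℓ T k<n L≤T = begin
  ℕ→ℚ ((n ∸ k) C suc ℓ)                                     ≡⟨ C-as-∑-s₁ (n ∸ k) (suc ℓ) ⟩
  d * (∑[ i < L ] ℤ→ℚ (s₁ (suc ℓ) i) * ℕ→ℚ (n ∸ k) ^ℚ i)    ≡⟨ cong (d *_) (∑-cong L (λ i → s₁-*-binomial ℓ i k<n)) ⟩
  d * (∑[ i < L ] ∑[ t < suc i ] u ^ℚ t * X t i)            ≡⟨ cong (d *_) (∑-triangle L (λ i t → u ^ℚ t * X t i)) ⟩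
  d * (∑[ t < L ] ∑[ j < L ∸ t ] u ^ℚ t * X t (t ℕ.+ j))    ≡⟨ *-distribˡ-∑ d L ⟩
  ∑[ t < L ] d * (∑[ j < L ∸ t ] u ^ℚ t * X t (t ℕ.+ j))    ≡⟨ ∑-cong L factor ⟩
  ∑[ t < L ] u ^ℚ t * a₆ ℓ n t                              ≡⟨ ∑-truncate L≤T (λ t L≤t _ → vanish t L≤t) ⟨
  ∑[ t < T ] u ^ℚ t * a₆ ℓ n t                              ∎
  where
  swap : ∀ a b c → a * (b * c) ≡ b * (a * c)
  swap = solve-∀ ℚ-ring
  L = suc (suc ℓ)
  d = 1/! (suc ℓ)
  u = ℕ→ℚ (suc k)
  X : ℕ → ℕ → ℚ
  X = a₆-summand ℓ n
  factor : ∀ t → d * (∑[ j < L ∸ t ] u ^ℚ t * X t (t ℕ.+ j)) ≡ u ^ℚ t * a₆ ℓ n t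
  factor t = begin
    d * (∑[ j < L ∸ t ] u ^ℚ t * X t (t ℕ.+ j))       ≡⟨ cong (d *_) (*-distribˡ-∑ (u ^ℚ t) (L ∸ t)) ⟨
    d * (u ^ℚ t * (∑[ j < L ∸ t ] X t (t ℕ.+ j)))     ≡⟨ swap d (u ^ℚ t) (∑[ j < L ∸ t ] X t (t ℕ.+ j)) ⟩
    u ^ℚ t * (d * (∑[ j < L ∸ t ] X t (t ℕ.+ j)))     ≡⟨ cong (u ^ℚ t *_) (a₆-as-∑ ℓ n t) ⟨
    u ^ℚ t * a₆ ℓ n t                                 ∎
  vanish : ∀ t → L ≤ t → u ^ℚ t * a₆ ℓ n t ≡ 0ℚ
  vanish t L≤t = trans (cong (u ^ℚ t *_) (a₆-vanishes ℓ n t L≤t)) (ℚ.*-zeroʳ (u ^ℚ t))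

theorem6 : (n p r : ℕ) → n ≥ 1 → p ≥ 1 → r ≥ 1 →
    sumFromTo 0 n (λ ℓ → ℕ→ℚ (ℓ ^ p) * H (n ∸ ℓ) (+ r))
      ≡ sumFromTo 0 (suc p) (λ t →
          H (n ∸ 1) (+ r - + t) *
          sumFromTo 1 p (λ ℓ → ℕ→ℚ (S₂ p ℓ ℕ.* (ℓ !)) * a₆ ℓ n t))
theorem6 (suc n) (suc p) r _ _ _ = begin
  sumFromTo 0 (suc n) (λ ℓ → ℕ→ℚ (ℓ ^ suc p) * H (suc n ∸ ℓ) (+ r))
    ≡⟨ trans (sumFromTo-∑ 0 (suc n) _)
             (∑-cong (suc (suc n)) (λ ℓ → cong (ℕ→ℚ (ℓ ^ suc p) *_) (H-as-∑ (suc n ∸ ℓ) (+ r)))) ⟩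
  ∑[ ℓ < suc (suc n) ] ℕ→ℚ (ℓ ^ suc p) * ∑< (suc n ∸ ℓ) w
    ≡⟨ ∑-convolution (suc n) (λ ℓ → ℕ→ℚ (ℓ ^ suc p)) w ⟩
  ∑[ k < suc n ] w k * (∑[ ℓ < suc n ∸ k ] ℕ→ℚ (ℓ ^ suc p))
    ≡⟨ ∑-cong (suc n) (λ k → cong (w k *_) (∑-^-S₂ p (suc n ∸ k))) ⟩
  ∑< (suc n) F
    ≡⟨ trans (cong (_+_ (∑< n F)) F[n]≡0) (ℚ.+-identityʳ (∑< n F)) ⟩
  ∑< n F
    ≡⟨ ∑-cong-< n (λ k k<n → cong (w k *_) (∑-cong-< (suc p) (λ j j<1+p →
         cong (c j *_) (C-as-∑-a₆ (suc j) T (ℕ.m<n⇒m<1+n k<n) (s≤s (s≤s j<1+p)))))) ⟩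
  ∑[ k < n ] w k * (∑[ j < suc p ] c j * (∑[ t < T ] ℕ→ℚ (suc k) ^ℚ t * a₆ (suc j) (suc n) t))
    ≡⟨ ∑-regroup n (suc p) T w c (λ k t → ℕ→ℚ (suc k) ^ℚ t) (λ j t → a₆ (suc j) (suc n) t) ⟩
  ∑[ t < T ] (∑[ k < n ] w k * ℕ→ℚ (suc k) ^ℚ t) * (∑[ j < suc p ] c j * a₆ (suc j) (suc n) t)
    ≡⟨ ∑-cong T (λ t → cong₂ _*_ (H-shift n r t) (sym (sumFromTo-∑ 1 (suc p) _))) ⟩
  ∑[ t < T ] H n (+ r - + t) * sumFromTo 1 (suc p) (λ ℓ → ℕ→ℚ (S₂ (suc p) ℓ ℕ.* (ℓ !)) * a₆ ℓ (suc n) t)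
    ≡⟨ sumFromTo-∑ 0 (suc (suc p)) _ ⟨
  sumFromTo 0 (suc (suc p)) (λ t → H (suc n ∸ 1) (+ r - + t) *
    sumFromTo 1 (suc p) (λ ℓ → ℕ→ℚ (S₂ (suc p) ℓ ℕ.* (ℓ !)) * a₆ ℓ (suc n) t)) ∎
  where
  T = suc (suc (suc p))
  w : ℕ → ℚ
  w k = powℤ k (ℤ.- + r)
  c : ℕ → ℚ
  c j = ℕ→ℚ (S₂ (suc p) (suc j) ℕ.* suc j !)
  F : ℕ → ℚ
  F k = w k * (∑[ j < suc p ] c j * ℕ→ℚ ((suc n ∸ k) C suc (suc j)))
  F[n]≡0 : F n ≡ 0ℚ
  F[n]≡0 = begin
    F n                               ≡⟨ cong (λ m → w n * (∑[ j < suc p ] c j * ℕ→ℚ (m C suc (suc j)))) (ℕ.m+n∸n≡m 1 n) ⟩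
    -- 1 C suc (suc j) computes to 0
    w n * (∑[ j < suc p ] c j * 0ℚ)   ≡⟨ cong (w n *_) (∑-zero (suc p) (λ j _ → ℚ.*-zeroʳ (c j))) ⟩
    w n * 0ℚ                          ≡⟨ ℚ.*-zeroʳ (w n) ⟩
    0ℚ                                ∎
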